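{- Let $\rho$ be a nonempty Cayley permutation (pattern), and let $\sigma$ be a $\rho$-minimal inversion sequence. Then $$|\sigma| - \mathbf{dist}(\sigma) = |\rho| - \mathbf{dist}(\rho) + \mathbf{mdd}(\rho).$$
   Context: An inversion sequence of length $n$ is an integer sequence $\sigma=(\sigma_1,\dots,\sigma_n)$ with $\sigma_i\in\{0,\dots,i-1\}$ for all $i$; $\mathcal I$ is the set of all inversion sequences. A Cayley permutation is an integer sequence whose set of values is exactly $\{0,\dots,m\}$ for its maximum $m$; $\mathcal P$ is the set of these. For integer sequences $\sigma$ and $\rho$, $\sigma$ contains $\rho$ (written $\rho\preceq\sigma$) if some subsequence of $|\rho|$ entries of $\sigma$ has its values in the same relative order as $\rho$. $|\sigma|$ is the length, $\mathbf{dist}(\sigma)$ the number of distinct values of $\sigma$, and $\mathbf{mdd}(\sigma)=\max_{i}(\sigma_i-i+1)$ (positions indexed from 1). For a nonempty Cayley permutation $\rho$, let $\mathcal{IP}[\rho]=\{\sigma\in\mathcal I\cap\mathcal P : \rho\preceq\sigma\}$; $\sigma$ is a $\rho$-minimal inversion sequence if it is a minimal element of the poset $(\mathcal{IP}[\rho],\preceq)$. -}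

module Defs where

open import Data.Nat using (ℕ; zero; suc; _<_; _≤_; _⊔_)
open import Data.Nat.Properties using (_≟_)
open import Data.Integer as ℤ using (ℤ; +_)
open import Data.List using (List; []; _∷_; length; lookup; deduplicate)
open import Data.List.Relation.Binary.Sublist.Propositional using (_⊆_)
open import Data.List.Relation.Unary.All using (All)
open import Data.List.Membership.Propositional using (_∈_)
open import Data.Fin using (Fin; toℕ)
open import Data.Product using (Σ; ∃; _×_)
open import Relation.Binary.PropositionalEquality using (_≡_)
open import Function.Bundles using (_⇔_)

-- Integer sequences are lists of naturals (all sequences here have
-- nonnegative entries).
Seq : Set
Seq = List ℕ

-- Inversion sequence: σ_i ∈ {0,…,i-1} (1-indexed), i.e. with 0-indexed
-- position k: lookup σ k < k + 1.
IsInversionSeq : Seq → Set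
IsInversionSeq σ = (k : Fin (length σ)) → lookup σ k < suc (toℕ k)

maxL : Seq → ℕ
maxL [] = 0
maxL (x ∷ xs) = x ⊔ maxL xs

IsCayley : Seq → Set
IsCayley [] = Data.Unit.⊤ where import Data.Unit
IsCayley σ@(_ ∷ _) = (v : ℕ) → v ≤ maxL σ → v ∈ σ

OrderIso : Seq → Seq → Set
OrderIso xs ys =
  Σ (length xs ≡ length ys) λ eq →
    (i j : Fin (length xs)) →
      ((lookup xs i < lookup xs j) ⇔ (lookup ys (Data.Fin.cast eq i) < lookup ys (Data.Fin.cast eq j)))
      × ((lookup xs i ≡ lookup xs j) ⇔ (lookup ys (Data.Fin.cast eq i) ≡ lookup ys (Data.Fin.cast eq j)))

_⪯_ : Seq → Seq → Set
ρ ⪯ σ = ∃ λ τ → (τ ⊆ σ) × OrderIso τ ρ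

InIP : Seq → Seq → Set
InIP ρ σ = IsInversionSeq σ × IsCayley σ × (ρ ⪯ σ)

IsMinimal : Seq → Seq → Set
IsMinimal ρ σ = InIP ρ σ × ((τ : Seq) → InIP ρ τ → τ ⪯ σ → τ ≡ σ)

dist : Seq → ℕ
dist σ = length (deduplicate _≟_ σ)

-- mdd(σ) = max_i (σ_i - i + 1), positions 1-indexed; defined for nonempty
-- sequences (value for [] is irrelevant; set to 0).
mddFrom : ℕ → ℤ → Seq → ℤ
mddFrom i acc [] = acc
mddFrom i acc (x ∷ xs) = mddFrom (suc i) (acc ℤ.⊔ ((+ x) ℤ.- (+ i) ℤ.+ ℤ.1ℤ)) xs

mdd : Seq → ℤ
mdd [] = ℤ.0ℤ
mdd (x ∷ xs) = mddFrom 2 (+ x) xs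

-- Write e(σ) = |σ| - dist σ, and let an occurrence of ρ in σ match the entry y of ρ at 0-based
-- index a with the entry w of σ at index q.
--
-- Lower bound, for every σ ∈ IP[ρ]: since σ is an inversion sequence, w ≤ q, at most q + 1 distinct
-- values of σ are ≤ q, and the larger ones all occur after index q. The occurrence has |ρ| - a - 1
-- entries after w, which carry at most dist ρ - y - 1 distinct values above w because ρ is Cayley;
-- each remaining entry after index q adds at most one distinct value. Hence e(σ) ≥ e(ρ) + y - a, and
-- y is chosen to attain mdd ρ = y - a.
--
-- Upper bound, for minimal σ: let t be the last index with σ_t = t. Deleting an entry at an index
-- ≥ t leaves an inversion sequence, which is Cayley after lowering the values above the deleted one
-- if that value disappears, and which still contains ρ unless the entry was used. So by minimality
-- the occurrence uses σ_t = t and every later entry. Every value ≤ t occurs in σ, and above t the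
-- occurrence alone has dist ρ - y - 1 distinct values, where y is matched with σ_t; this gives
-- e(σ) ≤ e(ρ) + y - a ≤ e(ρ) + mdd ρ.

module Submission where

open import Level using (Level)
open import Data.Nat using (ℕ; zero; suc; pred; _+_; _≤_; _<_; z≤n; s≤s; s≤s⁻¹)
open import Data.Nat.Properties
open import Data.List using (List; []; _∷_; length; _++_; map; filter; lookup; zip)
open import Data.List.Properties
  using (filter-all; filter-accept; filter-reject; length-map; length-++; map-++; ++-assoc; map-∘; map-id;
         ∷-injectiveˡ; ∷-injectiveʳ)
open import Data.List.Membership.Propositional using (_∈_; _∉_)
open import Data.List.Membership.Propositional.Properties
  using (∈-++⁺ˡ; ∈-++⁺ʳ; ∈-++⁻; ∈-map⁺; ∈-map⁻; ∈-deduplicate⁺; ∈-deduplicate⁻)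
open import Data.List.Membership.DecPropositional _≟_ using (_∈?_)
open import Data.List.Relation.Unary.All as All using (All; []; _∷_)
open import Data.List.Relation.Unary.All.Properties using (¬Any⇒All¬)
open import Data.List.Relation.Unary.Any using (here; there)
open import Data.List.Relation.Unary.Unique.Propositional using (Unique; _∷_)
open import Data.List.Relation.Unary.Unique.DecPropositional.Properties using (deduplicate-!)
open import Data.List.Relation.Binary.Sublist.Propositional using (_⊆_; []; _∷_; _∷ʳ_; ⊆-refl)
open import Data.List.Relation.Binary.Sublist.Heterogeneous.Properties using (++⁺)
open import Data.List.Relation.Binary.Sublist.Propositional.Properties
  using (Any-resp-⊆; All-resp-⊆; map⁺)
open import Data.Product using (∃; _×_; _,_; proj₁; proj₂; map₁)
open import Data.Sum as Sum using (_⊎_; inj₁; inj₂; [_,_])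
open import Data.Empty using (⊥-elim)
open import Data.Fin using (zero; suc; cast; toℕ)
open import Data.Unit using (⊤)
open import Function using (_∘_)
open import Function.Bundles using (_⇔_; mk⇔; Equivalence)
open import Function.Construct.Composition using (_⇔-∘_)
open import Function.Construct.Symmetry using (⇔-sym)
open import Relation.Nullary using (¬_; yes; no; ¬?)
open import Relation.Binary using (tri<; tri≈; tri>)
open import Relation.Unary using (Pred; Decidable; ∁)
open import Relation.Unary.Properties using (U?)
open import Relation.Binary.PropositionalEquality hiding ([_])

open import Defs
open import Data.Integer as ℤ using (ℤ; +_; _-_; 0ℤ; 1ℤ)
import Data.Integer.Properties as ℤ
import Data.Nat.Tactic.RingSolver as ℕ-Ring
import Data.Integer.Tactic.RingSolver as ℤ-Ring

private
  variable
    ℓ ℓ′ ℓ″ : Level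
    P : Pred ℕ ℓ
    Q : Pred ℕ ℓ′
    R : Pred ℕ ℓ″

-- Counting distinct values

countDistinct : Decidable P → List ℕ → ℕ
countDistinct P? [] = 0
countDistinct P? (x ∷ xs) with x ∈? xs | P? x
... | yes _ | _     = countDistinct P? xs
... | no _  | yes _ = suc (countDistinct P? xs)
... | no _  | no _  = countDistinct P? xs

module _ (P? : Decidable P) where

  countDistinct-∷ : ∀ x xs → countDistinct P? xs ≤ countDistinct P? (x ∷ xs)
  countDistinct-∷ x xs with x ∈? xs | P? x
  ... | yes _ | _     = ≤-refl
  ... | no _  | yes _ = n≤1+n _
  ... | no _  | no _  = ≤-refl

  countDistinct-∷-≤ : ∀ x xs → countDistinct P? (x ∷ xs) ≤ suc (countDistinct P? xs)
  countDistinct-∷-≤ x xs with x ∈? xs | P? x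
  ... | yes _ | _     = n≤1+n _
  ... | no _  | yes _ = ≤-refl
  ... | no _  | no _  = n≤1+n _

  countDistinct-++ʳ : ∀ xs ys → countDistinct P? ys ≤ countDistinct P? (xs ++ ys)
  countDistinct-++ʳ []       ys = ≤-refl
  countDistinct-++ʳ (x ∷ xs) ys = ≤-trans (countDistinct-++ʳ xs ys) (countDistinct-∷ x (xs ++ ys))

  countDistinct-++ : ∀ xs ys → countDistinct P? (xs ++ ys) ≤ countDistinct P? xs + countDistinct P? ys
  countDistinct-++ []       ys = ≤-refl
  countDistinct-++ (x ∷ xs) ys with x ∈? xs ++ ys | x ∈? xs | P? x
  ... | yes _   | yes _  | _     = countDistinct-++ xs ys
  ... | yes _   | no _   | yes _ = m≤n⇒m≤1+n (countDistinct-++ xs ys)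
  ... | yes _   | no _   | no _  = countDistinct-++ xs ys
  ... | no x∉ys | yes x∈ | _     = ⊥-elim (x∉ys (∈-++⁺ˡ x∈))
  ... | no _    | no _   | yes _ = s≤s (countDistinct-++ xs ys)
  ... | no _    | no _   | no _  = countDistinct-++ xs ys

  countDistinct-∷-reject : ∀ {x} xs → ¬ P x → countDistinct P? (x ∷ xs) ≡ countDistinct P? xs
  countDistinct-∷-reject {x} xs ¬px with x ∈? xs | P? x
  ... | yes _ | _     = refl
  ... | no _  | yes px = ⊥-elim (¬px px)
  ... | no _  | no _   = refl

  countDistinct-none : ∀ {xs} → All (∁ P) xs → countDistinct P? xs ≡ 0
  countDistinct-none []                   = refl
  countDistinct-none {_ ∷ xs} (¬px ∷ ¬ps) = trans (countDistinct-∷-reject xs ¬px) (countDistinct-none ¬ps)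

  -- Deleting an entry loses at most one distinct value.
  countDistinct-⊆ : ∀ {zs ys} → zs ⊆ ys →
                    length zs + countDistinct P? ys ≤ length ys + countDistinct P? zs
  countDistinct-⊆ [] = z≤n
  countDistinct-⊆ {zs} {y ∷ ys} (.y ∷ʳ zs⊆ys) = begin
    length zs + countDistinct P? (y ∷ ys)   ≤⟨ +-monoʳ-≤ (length zs) (countDistinct-∷-≤ y ys) ⟩
    length zs + suc (countDistinct P? ys)   ≡⟨ +-suc _ _ ⟩
    suc (length zs + countDistinct P? ys)   ≤⟨ s≤s (countDistinct-⊆ zs⊆ys) ⟩
    suc (length ys + countDistinct P? zs)   ∎
    where open ≤-Reasoning
  countDistinct-⊆ {z ∷ zs} {.z ∷ ys} (refl ∷ zs⊆ys) with z ∈? ys | z ∈? zs | P? z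
  ... | yes _   | yes _  | _     = s≤s (countDistinct-⊆ zs⊆ys)
  ... | yes _   | no _   | yes _ = s≤s (≤-trans (countDistinct-⊆ zs⊆ys) (+-monoʳ-≤ _ (n≤1+n _)))
  ... | yes _   | no _   | no _  = s≤s (countDistinct-⊆ zs⊆ys)
  ... | no z∉ys | yes z∈ | _     = ⊥-elim (z∉ys (Any-resp-⊆ zs⊆ys z∈))
  ... | no _    | no _   | yes _ = s≤s (begin
    length zs + suc (countDistinct P? ys)   ≡⟨ +-suc _ _ ⟩
    suc (length zs + countDistinct P? ys)   ≤⟨ s≤s (countDistinct-⊆ zs⊆ys) ⟩
    suc (length ys + countDistinct P? zs)   ≡⟨ +-suc _ _ ⟨
    length ys + suc (countDistinct P? zs)   ∎)
    where open ≤-Reasoning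
  ... | no _    | no _   | no _  = s≤s (countDistinct-⊆ zs⊆ys)

countDistinct-mono : (P? : Decidable P) (Q? : Decidable Q) → (∀ {v} → P v → Q v) →
                     ∀ xs → countDistinct P? xs ≤ countDistinct Q? xs
countDistinct-mono P? Q? P⇒Q [] = z≤n
countDistinct-mono P? Q? P⇒Q (x ∷ xs) with x ∈? xs | P? x | Q? x
... | yes _ | _      | _      = countDistinct-mono P? Q? P⇒Q xs
... | no _  | yes _  | yes _  = s≤s (countDistinct-mono P? Q? P⇒Q xs)
... | no _  | yes px | no ¬qx = ⊥-elim (¬qx (P⇒Q px))
... | no _  | no _   | yes _  = m≤n⇒m≤1+n (countDistinct-mono P? Q? P⇒Q xs)
... | no _  | no _   | no _   = countDistinct-mono P? Q? P⇒Q xs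

countDistinct-partition : (P? : Decidable P) (Q? : Decidable Q) (R? : Decidable R) →
  (∀ {v} → P v → Q v ⊎ R v) → (∀ {v} → Q v ⊎ R v → P v) → (∀ {v} → Q v → ¬ R v) →
  ∀ xs → countDistinct P? xs ≡ countDistinct Q? xs + countDistinct R? xs
countDistinct-partition P? Q? R? to from disjoint [] = refl
countDistinct-partition P? Q? R? to from disjoint (x ∷ xs)
  with ih ← countDistinct-partition P? Q? R? to from disjoint xs
  with x ∈? xs | P? x | Q? x | R? x
... | yes _ | _      | _      | _      = ih
... | no _  | yes _  | yes qx | yes rx = ⊥-elim (disjoint qx rx)
... | no _  | yes _  | yes _  | no _   = cong suc ih
... | no _  | yes _  | no _   | yes _  = trans (cong suc ih) (sym (+-suc _ _))
... | no _  | yes px | no ¬qx | no ¬rx = ⊥-elim ([ ¬qx , ¬rx ] (to px))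
... | no _  | no ¬px | yes qx | _      = ⊥-elim (¬px (from (inj₁ qx)))
... | no _  | no ¬px | no _   | yes rx = ⊥-elim (¬px (from (inj₂ rx)))
... | no _  | no _   | no _   | no _   = ih

countDistinct-<-suc : ∀ B xs →
  countDistinct (_<? suc B) xs ≡ countDistinct (_<? B) xs + countDistinct (_≟ B) xs
countDistinct-<-suc B = countDistinct-partition (_<? suc B) (_<? B) (_≟ B)
  (m<1+n⇒m<n∨m≡n) [ m<n⇒m<1+n , (λ { refl → n<1+n B }) ] <⇒≢

countDistinct-≡-≤1 : ∀ c xs → countDistinct (_≟ c) xs ≤ 1
countDistinct-≡-≤1 c [] = z≤n
countDistinct-≡-≤1 c (x ∷ xs) with x ∈? xs | x ≟ c
... | yes _   | _        = countDistinct-≡-≤1 c xs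
... | no x∉xs | yes refl =
  s≤s (≤-reflexive (countDistinct-none (_≟ x) (All.map ≢-sym (¬Any⇒All¬ xs x∉xs))))
... | no _    | no _     = countDistinct-≡-≤1 c xs

countDistinct-≡-∈ : ∀ {c xs} → c ∈ xs → 1 ≤ countDistinct (_≟ c) xs
countDistinct-≡-∈ {c} {x ∷ xs} c∈ with x ∈? xs | x ≟ c | c∈
... | yes x∈xs | _       | here refl  = countDistinct-≡-∈ x∈xs
... | yes _    | _       | there c∈xs = countDistinct-≡-∈ c∈xs
... | no _     | yes _   | _          = s≤s z≤n
... | no _     | no x≢c  | here c≡x   = ⊥-elim (x≢c (sym c≡x))
... | no _     | no _    | there c∈xs = countDistinct-≡-∈ c∈xs

countDistinct-<-≤ : ∀ B xs → countDistinct (_<? B) xs ≤ B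
countDistinct-<-≤ zero xs = ≤-reflexive (countDistinct-none (_<? 0) {xs} (All.tabulate λ _ ()))
countDistinct-<-≤ (suc B) xs = begin
  countDistinct (_<? suc B) xs                        ≡⟨ countDistinct-<-suc B xs ⟩
  countDistinct (_<? B) xs + countDistinct (_≟ B) xs  ≤⟨ +-mono-≤ (countDistinct-<-≤ B xs)
                                                                  (countDistinct-≡-≤1 B xs) ⟩
  B + 1                                               ≡⟨ +-comm B 1 ⟩
  suc B                                               ∎
  where open ≤-Reasoning

countDistinct-<-≥ : ∀ B xs → (∀ {v} → v < B → v ∈ xs) → B ≤ countDistinct (_<? B) xs
countDistinct-<-≥ zero xs all-in = z≤n
countDistinct-<-≥ (suc B) xs all-in = begin
  suc B                                               ≡⟨ +-comm 1 B ⟩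
  B + 1                                               ≤⟨ +-mono-≤ (countDistinct-<-≥ B xs (all-in ∘ m<n⇒m<1+n))
                                                                  (countDistinct-≡-∈ (all-in (n<1+n B))) ⟩
  countDistinct (_<? B) xs + countDistinct (_≟ B) xs  ≡⟨ countDistinct-<-suc B xs ⟨
  countDistinct (_<? suc B) xs                        ∎
  where open ≤-Reasoning

length-filter-≢ : ∀ {x D} → Unique D → x ∈ D → suc (length (filter (¬? ∘ (x ≟_)) D)) ≡ length D
length-filter-≢ {x} {d ∷ D} (d∉D ∷ uD) (here refl) = begin
  suc (length (filter x≢? (x ∷ D)))   ≡⟨ cong (suc ∘ length) (filter-reject x≢? (λ x≢x → x≢x refl)) ⟩
  suc (length (filter x≢? D))         ≡⟨ cong (suc ∘ length) (filter-all x≢? d∉D) ⟩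
  suc (length D)                      ∎
  where
    open ≡-Reasoning
    x≢? = ¬? ∘ (x ≟_)
length-filter-≢ {x} {d ∷ D} (d∉D ∷ uD) (there x∈D) with x ≟ d
... | yes refl = ⊥-elim (All.lookup d∉D x∈D refl)
... | no x≢d   = begin
  suc (length (filter x≢? (d ∷ D)))   ≡⟨ cong (suc ∘ length) (filter-accept x≢? x≢d) ⟩
  suc (suc (length (filter x≢? D)))   ≡⟨ cong suc (length-filter-≢ uD x∈D) ⟩
  suc (length D)                      ∎
  where
    open ≡-Reasoning
    x≢? = ¬? ∘ (x ≟_)

dist≡countDistinct : ∀ xs → dist xs ≡ countDistinct U? xs
dist≡countDistinct [] = refl
dist≡countDistinct (x ∷ xs) with x ∈? xs
... | yes x∈xs =
  trans (length-filter-≢ (deduplicate-! _≟_ xs) (∈-deduplicate⁺ _≟_ x∈xs)) (dist≡countDistinct xs)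
... | no x∉xs  = cong suc (trans
  (cong length (filter-all (¬? ∘ (x ≟_)) (¬Any⇒All¬ _ (x∉xs ∘ ∈-deduplicate⁻ _≟_ xs))))
  (dist≡countDistinct xs))

distAbove : ℕ → List ℕ → ℕ
distAbove c = countDistinct (c <?_)

dist-split : ∀ c xs → dist xs ≡ distAbove c xs + countDistinct (_<? suc c) xs
dist-split c xs = trans (dist≡countDistinct xs)
  (countDistinct-partition U? (c <?_) (_<? suc c)
    (λ {v} _ → Sum.swap (Sum.map₁ s≤s (≤-<-connex v c))) (λ _ → _)
    (λ c<v v<1+c → <⇒≱ c<v (s≤s⁻¹ v<1+c)) xs)

dist-≤ : ∀ c xs → dist xs ≤ distAbove c xs + suc c
dist-≤ c xs = begin
  dist xs                                           ≡⟨ dist-split c xs ⟩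
  distAbove c xs + countDistinct (_<? suc c) xs     ≤⟨ +-monoʳ-≤ _ (countDistinct-<-≤ (suc c) xs) ⟩
  distAbove c xs + suc c                            ∎
  where open ≤-Reasoning

dist-≡ : ∀ {c xs} → (∀ {v} → v ≤ c → v ∈ xs) → dist xs ≡ distAbove c xs + suc c
dist-≡ {c} {xs} all-in = trans (dist-split c xs) (cong (λ n → distAbove c xs + n)
  (≤-antisym (countDistinct-<-≤ (suc c) xs) (countDistinct-<-≥ (suc c) xs (all-in ∘ s≤s⁻¹))))

-- Occurrences as matchings

Concordant : ℕ × ℕ → ℕ × ℕ → Set
Concordant (a , b) (c , d) = ((a < c) ⇔ (b < d)) × ((a ≡ c) ⇔ (b ≡ d))

-- Two sequences are order-isomorphic iff they are the two projections of a matching.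
IsMatching : List (ℕ × ℕ) → Set
IsMatching ps = ∀ {p q} → p ∈ ps → q ∈ ps → Concordant p q

concordant-relabel : ∀ {a b c d a′ c′} →
  Concordant (a , b) (c , d) → Concordant (a , a′) (c , c′) → Concordant (a′ , b) (c′ , d)
concordant-relabel (<⇔ , ≡⇔) (<⇔′ , ≡⇔′) = <⇔ ⇔-∘ ⇔-sym <⇔′ , ≡⇔ ⇔-∘ ⇔-sym ≡⇔′

map-proj₁-zip : ∀ (xs ys : List ℕ) → length xs ≡ length ys → map proj₁ (zip xs ys) ≡ xs
map-proj₁-zip []       []       _  = refl
map-proj₁-zip (x ∷ xs) (y ∷ ys) eq = cong (x ∷_) (map-proj₁-zip xs ys (suc-injective eq))

map-proj₂-zip : ∀ (xs ys : List ℕ) → length xs ≡ length ys → map proj₂ (zip xs ys) ≡ ys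
map-proj₂-zip []       []       _  = refl
map-proj₂-zip (x ∷ xs) (y ∷ ys) eq = cong (y ∷_) (map-proj₂-zip xs ys (suc-injective eq))

∈-zip⁻ : ∀ (xs ys : List ℕ) (eq : length xs ≡ length ys) {p} → p ∈ zip xs ys →
         ∃ λ i → p ≡ (lookup xs i , lookup ys (cast eq i))
∈-zip⁻ (x ∷ xs) (y ∷ ys) eq (here refl) = zero , refl
∈-zip⁻ (x ∷ xs) (y ∷ ys) eq (there p∈) with ∈-zip⁻ xs ys (suc-injective eq) p∈
... | i , refl = suc i , refl

∈-lookup-proj : ∀ (ps : List (ℕ × ℕ)) .(eq : length (map proj₁ ps) ≡ length (map proj₂ ps)) i →
                (lookup (map proj₁ ps) i , lookup (map proj₂ ps) (cast eq i)) ∈ ps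
∈-lookup-proj (p ∷ ps) eq zero    = here refl
∈-lookup-proj (p ∷ ps) eq (suc i) = there (∈-lookup-proj ps (suc-injective eq) i)

orderIso⇒matching : ∀ {xs ys} → OrderIso xs ys →
                    ∃ λ ps → IsMatching ps × map proj₁ ps ≡ xs × map proj₂ ps ≡ ys
orderIso⇒matching {xs} {ys} (eq , iso) =
  zip xs ys , matching , map-proj₁-zip xs ys eq , map-proj₂-zip xs ys eq
  where
    matching : IsMatching (zip xs ys)
    matching p∈ q∈ with ∈-zip⁻ xs ys eq p∈ | ∈-zip⁻ xs ys eq q∈
    ... | i , refl | j , refl = iso i j

matching⇒orderIso : ∀ {ps xs ys} →
  IsMatching ps → map proj₁ ps ≡ xs → map proj₂ ps ≡ ys → OrderIso xs ys
matching⇒orderIso {ps} matching refl refl =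
  eq , λ i j → matching (∈-lookup-proj ps eq i) (∈-lookup-proj ps eq j)
  where eq = trans (length-map proj₁ ps) (sym (length-map proj₂ ps))

module _ {a b ps} (matching : IsMatching ((a , b) ∷ ps)) where

  matching-∈-proj₁ : a ∈ map proj₁ ps → b ∈ map proj₂ ps
  matching-∈-proj₁ a∈ with ∈-map⁻ proj₁ a∈
  ... | (_ , b′) , ab′∈ , refl = subst (_∈ map proj₂ ps) (sym b≡b′) (∈-map⁺ proj₂ ab′∈)
    where b≡b′ = Equivalence.to (proj₂ (matching (here refl) (there ab′∈))) refl

  matching-∈-proj₂ : b ∈ map proj₂ ps → a ∈ map proj₁ ps
  matching-∈-proj₂ b∈ with ∈-map⁻ proj₂ b∈
  ... | (a′ , _) , a′b∈ , refl = subst (_∈ map proj₁ ps) (sym a≡a′) (∈-map⁺ proj₁ a′b∈)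
    where a≡a′ = Equivalence.from (proj₂ (matching (here refl) (there a′b∈))) refl

countDistinct-transfer : (P? : Decidable P) (Q? : Decidable Q) → ∀ {ps} → IsMatching ps →
  (∀ {a b} → (a , b) ∈ ps → P a ⇔ Q b) →
  countDistinct P? (map proj₁ ps) ≡ countDistinct Q? (map proj₂ ps)
countDistinct-transfer P? Q? {[]} _ _ = refl
countDistinct-transfer P? Q? {(a , b) ∷ ps} matching P⇔Q
  with ih ← countDistinct-transfer P? Q? (λ p∈ q∈ → matching (there p∈) (there q∈)) (P⇔Q ∘ there)
  with a ∈? map proj₁ ps | b ∈? map proj₂ ps | P? a | Q? b
... | yes _  | yes _  | _      | _      = ih
... | yes a∈ | no b∉  | _      | _      = ⊥-elim (b∉ (matching-∈-proj₁ matching a∈))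
... | no a∉  | yes b∈ | _      | _      = ⊥-elim (a∉ (matching-∈-proj₂ matching b∈))
... | no _   | no _   | yes _  | yes _  = cong suc ih
... | no _   | no _   | yes pa | no ¬qb = ⊥-elim (¬qb (Equivalence.to (P⇔Q (here refl)) pa))
... | no _   | no _   | no ¬pa | yes qb = ⊥-elim (¬pa (Equivalence.from (P⇔Q (here refl)) qb))
... | no _   | no _   | no _   | no _   = ih

OrderEmbeddingOn : List ℕ → (ℕ → ℕ) → Set
OrderEmbeddingOn R g = ∀ {a c} → a ∈ R → c ∈ R → Concordant (a , g a) (c , g c)

⪯-map : ∀ {ρ R g} → OrderEmbeddingOn R g → ρ ⪯ R → ρ ⪯ map g R
⪯-map {ρ} {R} {g} embedding (τ , τ⊆R , τ≅ρ) with orderIso⇒matching {τ} {ρ} τ≅ρ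
... | ps , matching , refl , refl =
  map g (map proj₁ ps) , map⁺ g τ⊆R ,
  matching⇒orderIso relabelled (trans (sym (map-∘ ps)) (map-∘ ps)) (sym (map-∘ ps))
  where
    relabelled : IsMatching (map (map₁ g) ps)
    relabelled p∈ q∈ with ∈-map⁻ (map₁ g) p∈ | ∈-map⁻ (map₁ g) q∈
    ... | (a , _) , ab∈ , refl | (c , _) , cd∈ , refl =
      concordant-relabel (matching ab∈ cd∈)
        (embedding (Any-resp-⊆ τ⊆R (∈-map⁺ proj₁ ab∈)) (Any-resp-⊆ τ⊆R (∈-map⁺ proj₁ cd∈)))

map-⪯ : ∀ {R σ g} → OrderEmbeddingOn R g → R ⊆ σ → map g R ⪯ σ
map-⪯ {R} {σ} {g} embedding R⊆σ =
  R , R⊆σ , matching⇒orderIso graph (trans (sym (map-∘ R)) (map-id R)) (sym (map-∘ R))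
  where
    graph : IsMatching (map (λ a → a , g a) R)
    graph p∈ q∈ with ∈-map⁻ _ p∈ | ∈-map⁻ _ q∈
    ... | a , a∈ , refl | c , c∈ , refl = embedding a∈ c∈

strictlyMonotone⇒orderEmbedding : ∀ {R g} →
  (∀ {a c} → a ∈ R → c ∈ R → a < c → g a < g c) → OrderEmbeddingOn R g
strictlyMonotone⇒orderEmbedding {R} {g} mono {a} {c} a∈ c∈ with <-cmp a c
... | tri< a<c a≢c _ =
  mk⇔ (λ _ → mono a∈ c∈ a<c) (λ _ → a<c) ,
  mk⇔ (⊥-elim ∘ a≢c) (λ ga≡gc → ⊥-elim (<-irrefl ga≡gc (mono a∈ c∈ a<c)))
... | tri≈ a≮a refl _ =
  mk⇔ (⊥-elim ∘ a≮a) (⊥-elim ∘ <-irrefl refl) , mk⇔ (λ _ → refl) (λ _ → refl)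
... | tri> a≮c a≢c c<a =
  mk⇔ (⊥-elim ∘ a≮c) (λ ga<gc → ⊥-elim (<-asym ga<gc (mono c∈ a∈ c<a))) ,
  mk⇔ (⊥-elim ∘ a≢c) (λ ga≡gc → ⊥-elim (<-irrefl (sym ga≡gc) (mono c∈ a∈ c<a)))

occurrence-in-[] : ∀ {τ ρ} → τ ⊆ [] → OrderIso τ ρ → ρ ≡ []
occurrence-in-[] {ρ = []}    [] _       = refl
occurrence-in-[] {ρ = _ ∷ _} [] (() , _)

⊆-++⁻ : ∀ {zs : List ℕ} A B → zs ⊆ A ++ B →
  ∃ λ zA → ∃ λ zB → zs ≡ zA ++ zB × zA ⊆ A × zB ⊆ B
⊆-++⁻ []      B zs⊆B = [] , _ , refl , [] , zs⊆B
⊆-++⁻ (a ∷ A) B (.a ∷ʳ zs⊆) with ⊆-++⁻ A B zs⊆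
... | zA , zB , refl , zA⊆A , zB⊆B = zA , zB , refl , a ∷ʳ zA⊆A , zB⊆B
⊆-++⁻ (a ∷ A) B (refl ∷ zs⊆) with ⊆-++⁻ A B zs⊆
... | zA , zB , refl , zA⊆A , zB⊆B = a ∷ zA , zB , refl , refl ∷ zA⊆A , zB⊆B

⊆-≡⊎skip : ∀ {zs ys : List ℕ} → zs ⊆ ys →
  zs ≡ ys ⊎ ∃ λ Y₁ → ∃ λ y → ∃ λ Y₂ → ys ≡ Y₁ ++ y ∷ Y₂ × zs ⊆ Y₁ ++ Y₂
⊆-≡⊎skip [] = inj₁ refl
⊆-≡⊎skip {ys = y ∷ ys} (.y ∷ʳ zs⊆ys) = inj₂ ([] , y , ys , refl , zs⊆ys)
⊆-≡⊎skip (refl ∷ zs⊆ys) with ⊆-≡⊎skip zs⊆ys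
... | inj₁ refl = inj₁ refl
... | inj₂ (Y₁ , y , Y₂ , refl , zs⊆Y) = inj₂ (_ ∷ Y₁ , y , Y₂ , refl , refl ∷ zs⊆Y)

⊆-locate : ∀ (τA : List ℕ) w τB {σ} → τA ++ w ∷ τB ⊆ σ →
  ∃ λ A → ∃ λ B → σ ≡ A ++ w ∷ B × τA ⊆ A × τB ⊆ B
⊆-locate []       w τB (y ∷ʳ τ⊆) with ⊆-locate [] w τB τ⊆
... | A , B , refl , τA⊆A , τB⊆B = y ∷ A , B , refl , y ∷ʳ τA⊆A , τB⊆B
⊆-locate []       w τB (refl ∷ τB⊆) = [] , _ , refl , [] , τB⊆
⊆-locate (a ∷ τA) w τB (y ∷ʳ τ⊆) with ⊆-locate (a ∷ τA) w τB τ⊆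
... | A , B , refl , τA⊆A , τB⊆B = y ∷ A , B , refl , y ∷ʳ τA⊆A , τB⊆B
⊆-locate (a ∷ τA) w τB (refl ∷ τ⊆) with ⊆-locate τA w τB τ⊆
... | A , B , refl , τA⊆A , τB⊆B = a ∷ A , B , refl , refl ∷ τA⊆A , τB⊆B

map-split : ∀ {X : Set} (f : X → ℕ) (xs : List X) A y B → map f xs ≡ A ++ y ∷ B →
  ∃ λ xA → ∃ λ x → ∃ λ xB → xs ≡ xA ++ x ∷ xB × map f xA ≡ A × f x ≡ y × map f xB ≡ B
map-split f (x ∷ xs) []      y B eq = [] , x , xs , refl , refl , ∷-injectiveˡ eq , ∷-injectiveʳ eq
map-split f (x ∷ xs) (a ∷ A) y B eq with map-split f xs A y B (∷-injectiveʳ eq)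
... | xA , x′ , xB , refl , refl , fx′≡y , refl =
  x ∷ xA , x′ , xB , refl , cong (_∷ _) (∷-injectiveˡ eq) , fx′≡y , refl

-- Inversion sequences and Cayley permutations

-- Every entry of xs at 0-based index k is below o + k; inversion sequences are the lists bounded from 1.
BoundedFrom : ℕ → List ℕ → Set
BoundedFrom o []       = ⊤
BoundedFrom o (x ∷ xs) = x < o × BoundedFrom (suc o) xs

boundedFrom-lookup : ∀ o xs → (∀ k → lookup xs k < o + toℕ k) → BoundedFrom o xs
boundedFrom-lookup o []       _       = _
boundedFrom-lookup o (x ∷ xs) bounded =
  subst (x <_) (+-identityʳ o) (bounded zero) ,
  boundedFrom-lookup (suc o) xs (λ k → subst (lookup xs k <_) (+-suc o (toℕ k)) (bounded (suc k)))

lookup-boundedFrom : ∀ {o xs} → BoundedFrom o xs → ∀ k → lookup xs k < o + toℕ k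
lookup-boundedFrom {o} {x ∷ xs} (x<o , _)  zero    = subst (x <_) (sym (+-identityʳ o)) x<o
lookup-boundedFrom {o} {x ∷ xs} (_ , rest) (suc k) =
  subst (lookup xs k <_) (sym (+-suc o (toℕ k))) (lookup-boundedFrom rest k)

boundedFrom-++⁻ˡ : ∀ {o} A {B} → BoundedFrom o (A ++ B) → BoundedFrom o A
boundedFrom-++⁻ˡ []      _          = _
boundedFrom-++⁻ˡ (x ∷ A) (x<o , AB) = x<o , boundedFrom-++⁻ˡ A AB

boundedFrom-++⁻ʳ : ∀ {o} A {B} → BoundedFrom o (A ++ B) → BoundedFrom (o + length A) B
boundedFrom-++⁻ʳ {o} []      {B} B-bounded =
  subst (λ o′ → BoundedFrom o′ B) (sym (+-identityʳ o)) B-bounded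
boundedFrom-++⁻ʳ {o} (x ∷ A) {B} (_ , AB)  =
  subst (λ o′ → BoundedFrom o′ B) (sym (+-suc o (length A))) (boundedFrom-++⁻ʳ A AB)

boundedFrom-++⁺ : ∀ {o} A {B} → BoundedFrom o A → BoundedFrom (o + length A) B → BoundedFrom o (A ++ B)
boundedFrom-++⁺ {o} []      {B} _          B-bounded =
  subst (λ o′ → BoundedFrom o′ B) (+-identityʳ o) B-bounded
boundedFrom-++⁺ {o} (x ∷ A) {B} (x<o , As) B-bounded =
  x<o , boundedFrom-++⁺ A As (subst (λ o′ → BoundedFrom o′ B) (+-suc o (length A)) B-bounded)

boundedFrom-map : ∀ {g} → (∀ u → g u ≤ u) → ∀ {o} xs → BoundedFrom o xs → BoundedFrom o (map g xs)
boundedFrom-map g≤ []       _          = _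
boundedFrom-map g≤ (x ∷ xs) (x<o , xs′) = ≤-<-trans (g≤ x) x<o , boundedFrom-map g≤ xs xs′

boundedFrom-All : ∀ {o} xs → BoundedFrom o xs → All (_< o + length xs) xs
boundedFrom-All         []       _          = []
boundedFrom-All {o} (x ∷ xs) (x<o , xs′) =
  ≤-trans x<o (m≤m+n o (suc (length xs))) ∷
  All.map (λ {v} → subst (v <_) (sym (+-suc o (length xs)))) (boundedFrom-All xs xs′)

boundedFrom-lastTight : ∀ o xs → BoundedFrom (suc o) xs →
  BoundedFrom o xs ⊎ ∃ λ A → ∃ λ t → ∃ λ B →
    xs ≡ A ++ t ∷ B × t ≡ o + length A × BoundedFrom (suc (o + length A)) B
boundedFrom-lastTight o []       _ = inj₁ _
boundedFrom-lastTight o (x ∷ xs) (x<1+o , xs′) with boundedFrom-lastTight (suc o) xs xs′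
... | inj₂ (A , t , B , refl , t≡ , B′) =
  inj₂ (x ∷ A , t , B , refl , trans t≡ (sym (+-suc o (length A))) ,
        subst (λ o′ → BoundedFrom (suc o′) B) (sym (+-suc o (length A))) B′)
... | inj₁ xs″ with m<1+n⇒m<n∨m≡n x<1+o
...   | inj₁ x<o  = inj₁ (x<o , xs″)
...   | inj₂ refl = inj₂ ([] , x , xs , refl , sym (+-identityʳ x) ,
                          subst (λ o′ → BoundedFrom (suc o′) xs) (sym (+-identityʳ x)) xs″)

DownClosed : List ℕ → Set
DownClosed xs = ∀ {u w} → u ∈ xs → w ≤ u → w ∈ xs

∈⇒≤maxL : ∀ {x} xs → x ∈ xs → x ≤ maxL xs
∈⇒≤maxL (y ∷ ys) (here refl) = m≤m⊔n y (maxL ys)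
∈⇒≤maxL (y ∷ ys) (there x∈) = ≤-trans (∈⇒≤maxL ys x∈) (m≤n⊔m y (maxL ys))

maxL∈ : ∀ x xs → maxL (x ∷ xs) ∈ x ∷ xs
maxL∈ x []       = here (⊔-identityʳ x)
maxL∈ x (y ∷ ys) with ⊔-sel x (maxL (y ∷ ys))
... | inj₁ x⊔m≡x = here x⊔m≡x
... | inj₂ x⊔m≡m = there (subst (_∈ y ∷ ys) (sym x⊔m≡m) (maxL∈ y ys))

isCayley⇒downClosed : ∀ xs → IsCayley xs → DownClosed xs
isCayley⇒downClosed (x ∷ xs) cayley u∈ w≤u = cayley _ (≤-trans w≤u (∈⇒≤maxL (x ∷ xs) u∈))

downClosed⇒isCayley : ∀ xs → DownClosed xs → IsCayley xs
downClosed⇒isCayley []       _      = _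
downClosed⇒isCayley (x ∷ xs) closed v v≤max = closed (maxL∈ x xs) v≤max

boundedFrom-zero : ∀ {xs} → BoundedFrom 0 xs → xs ≡ []
boundedFrom-zero {[]}    _       = refl
boundedFrom-zero {_ ∷ _} (() , _)

-- Deleting an entry

closeGap : ℕ → ℕ → ℕ
closeGap v u with v <? u
... | yes _ = pred u
... | no _  = u

closeGap-≤ : ∀ v u → closeGap v u ≤ u
closeGap-≤ v u with v <? u
... | yes _ = pred[n]≤n
... | no _  = ≤-refl

closeGap-< : ∀ {v w} → w < v → closeGap v w ≡ w
closeGap-< {v} {w} w<v with v <? w
... | yes v<w = ⊥-elim (<-asym v<w w<v)
... | no _    = refl

closeGap-suc : ∀ {v w} → v ≤ w → closeGap v (suc w) ≡ w
closeGap-suc {v} {w} v≤w with v <? suc w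
... | yes _    = refl
... | no v≮1+w = ⊥-elim (v≮1+w (s≤s v≤w))

closeGap-mono-< : ∀ v {a c} → a ≢ v → a < c → closeGap v a < closeGap v c
closeGap-mono-< v {a} {c} a≢v a<c with v <? a | v <? c
... | yes v<a | yes _    = pred-<-pred v<a a<c
  where
    pred-<-pred : ∀ {v a c} → v < a → a < c → pred a < pred c
    pred-<-pred {a = suc _} {suc _} _ a<c = s≤s⁻¹ a<c
... | yes v<a | no v≮c  = ⊥-elim (v≮c (<-trans v<a a<c))
... | no v≮a  | yes v<c = <-≤-trans (≤∧≢⇒< (≮⇒≥ v≮a) a≢v) (<⇒≤pred v<c)
... | no _    | no _    = a<c

closeGap-> : ∀ {v a} → v < a → closeGap v a ≡ pred a
closeGap-> {v} {a} v<a with v <? a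
... | yes _   = refl
... | no v≮a = ⊥-elim (v≮a v<a)

ImageDownClosed : List ℕ → (ℕ → ℕ) → Set
ImageDownClosed R g = ∀ {a w} → a ∈ R → w ≤ g a → ∃ λ a′ → a′ ∈ R × g a′ ≡ w

imageDownClosed⇒downClosed : ∀ {R g} → ImageDownClosed R g → DownClosed (map g R)
imageDownClosed⇒downClosed {g = g} closed u∈ w≤u with ∈-map⁻ g u∈
... | a , a∈ , refl with closed a∈ w≤u
...   | a′ , a′∈ , refl = ∈-map⁺ g a′∈

module _ {P v S} (closed : DownClosed (P ++ v ∷ S)) where

  private
    insert : ∀ {a} → a ∈ P ++ S → a ∈ P ++ v ∷ S
    insert = Any-resp-⊆ (++⁺ ⊆-refl (v ∷ʳ ⊆-refl))

    delete : ∀ {w} → w ∈ P ++ v ∷ S → w ≢ v → w ∈ P ++ S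
    delete w∈ w≢v with ∈-++⁻ P w∈
    ... | inj₁ w∈P          = ∈-++⁺ˡ w∈P
    ... | inj₂ (here w≡v)   = ⊥-elim (w≢v w≡v)
    ... | inj₂ (there w∈S)  = ∈-++⁺ʳ P w∈S

  id-imageDownClosed : v ∈ P ++ S → ImageDownClosed (P ++ S) (λ u → u)
  id-imageDownClosed v∈ {a} {w} a∈ w≤a with w ≟ v
  ... | yes refl = w , v∈ , refl
  ... | no w≢v   = w , delete (closed (insert a∈) w≤a) w≢v , refl

  closeGap-imageDownClosed : v ∉ P ++ S → ImageDownClosed (P ++ S) (closeGap v)
  closeGap-imageDownClosed v∉ {a} {w} a∈ w≤ with w <? v
  ... | yes w<v =
    w , delete (closed (insert a∈) (≤-trans w≤ (closeGap-≤ v a))) (<⇒≢ w<v) , closeGap-< w<v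
  ... | no w≮v with <-cmp a v
  ...   | tri< a<v _ _   = ⊥-elim (w≮v (≤-<-trans (subst (w ≤_) (closeGap-< a<v) w≤) a<v))
  ...   | tri≈ _ refl _  = ⊥-elim (v∉ a∈)
  ...   | tri> _ _ v<a   =
    suc w ,
    delete (closed (insert a∈) (suc≤ v<a (subst (w ≤_) (closeGap-> v<a) w≤))) (>⇒≢ (s≤s (≮⇒≥ w≮v))) ,
    closeGap-suc (≮⇒≥ w≮v)
    where
      suc≤ : ∀ {a} → v < a → w ≤ pred a → suc w ≤ a
      suc≤ {suc _} _ w≤a′ = s≤s w≤a′

-- S-bounded says that the entries after v stay within the inversion bound when moved one place left.
module _ {P v S} (inv : BoundedFrom 1 (P ++ v ∷ S)) (S-bounded : BoundedFrom (suc (length P)) S) where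

  relabel-shorter : ∀ {ρ g} → (∀ u → g u ≤ u) →
    (∀ {a c} → a ∈ P ++ S → c ∈ P ++ S → a < c → g a < g c) → ImageDownClosed (P ++ S) g → ρ ⪯ (P ++ S) →
    ∃ λ τ → InIP ρ τ × τ ⪯ (P ++ v ∷ S) × length τ < length (P ++ v ∷ S)
  relabel-shorter {ρ} {g} g≤ mono image-closed ρ⪯ =
    map g (P ++ S) ,
    (inversion , downClosed⇒isCayley _ (imageDownClosed⇒downClosed image-closed) ,
     ⪯-map {ρ} embedding ρ⪯) ,
    map-⪯ embedding (++⁺ ⊆-refl (v ∷ʳ ⊆-refl)) ,
    shorter
    where
      embedding = strictlyMonotone⇒orderEmbedding mono
      inversion : IsInversionSeq (map g (P ++ S))
      inversion = lookup-boundedFrom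
        (boundedFrom-map g≤ (P ++ S) (boundedFrom-++⁺ P (boundedFrom-++⁻ˡ P inv) S-bounded))
      shorter : length (map g (P ++ S)) < length (P ++ v ∷ S)
      shorter = begin-strict
        length (map g (P ++ S))     ≡⟨ length-map g (P ++ S) ⟩
        length (P ++ S)             ≡⟨ length-++ P ⟩
        length P + length S         <⟨ +-monoʳ-< (length P) (n<1+n (length S)) ⟩
        length P + suc (length S)   ≡⟨ length-++ P ⟨
        length (P ++ v ∷ S)         ∎
        where open ≤-Reasoning

  -- The values above v are lowered exactly when v no longer occurs.
  deleteEntry : ∀ {ρ} → DownClosed (P ++ v ∷ S) → ρ ⪯ (P ++ S) →
    ∃ λ τ → InIP ρ τ × τ ⪯ (P ++ v ∷ S) × length τ < length (P ++ v ∷ S)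
  deleteEntry {ρ} closed ρ⪯ with v ∈? P ++ S
  ... | yes v∈ =
    relabel-shorter {ρ} (λ _ → ≤-refl) (λ _ _ a<c → a<c) (id-imageDownClosed closed v∈) ρ⪯
  ... | no v∉  =
    relabel-shorter {ρ} (closeGap-≤ v) (λ a∈ _ → closeGap-mono-< v (λ { refl → v∉ a∈ }))
      (closeGap-imageDownClosed closed v∉) ρ⪯

minimal-undeletable : ∀ {ρ σ P v S} → IsMinimal ρ σ → σ ≡ P ++ v ∷ S → BoundedFrom (suc (length P)) S →
                      ¬ ρ ⪯ (P ++ S)
minimal-undeletable {ρ} ((inv , cayley , _) , minimal) refl S-bounded ρ⪯
  with deleteEntry (boundedFrom-lookup 1 _ inv) S-bounded {ρ} (isCayley⇒downClosed _ cayley) ρ⪯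
... | τ , τ∈IP , τ⪯σ , τ<σ = <-irrefl (cong length (minimal τ τ∈IP τ⪯σ)) τ<σ

-- An entry of t ∷ B left out of the occurrence could be deleted, contradicting minimality.
minimal-covers-suffix : ∀ {ρ A t B τ} → IsMinimal ρ (A ++ t ∷ B) → BoundedFrom (suc (length A)) B →
  τ ⊆ A ++ t ∷ B → OrderIso τ ρ → ∃ λ τA → τA ⊆ A × τ ≡ τA ++ t ∷ B
minimal-covers-suffix {ρ} {A} {t} {B} minimal B-bounded τ⊆ τ≅ρ with ⊆-++⁻ A (t ∷ B) τ⊆
... | τA , τR , refl , τA⊆A , (.t ∷ʳ τR⊆B) =
  ⊥-elim (minimal-undeletable {ρ} minimal refl B-bounded (_ , ++⁺ τA⊆A τR⊆B , τ≅ρ))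
... | τA , τR , refl , τA⊆A , (refl ∷ τR⊆B) with ⊆-≡⊎skip τR⊆B
...   | inj₁ refl = τA , τA⊆A , refl
...   | inj₂ (Y₁ , b , Y₂ , refl , τR⊆Y) =
  ⊥-elim (minimal-undeletable {ρ} minimal (sym (++-assoc A (t ∷ Y₁) (b ∷ Y₂))) Y₂-bounded
    (_ , subst (_ ⊆_) (sym (++-assoc A (t ∷ Y₁) Y₂)) (++⁺ τA⊆A (refl ∷ τR⊆Y)) , τ≅ρ))
  where
    Y₂-bounded : BoundedFrom (suc (length (A ++ t ∷ Y₁))) Y₂
    Y₂-bounded = subst (λ o → BoundedFrom o Y₂) (cong suc (sym (trans (length-++ A) (+-suc _ _))))
                   (proj₂ (boundedFrom-++⁻ʳ Y₁ B-bounded))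

-- The excess |σ| - dist σ and mdd

-- mddFrom i runs over 1-based positions i, i + 1, …, so the entry y at 0-based index a contributes y - a.
mddFrom-acc : ∀ i acc xs → acc ℤ.≤ mddFrom i acc xs
mddFrom-acc i acc []       = ℤ.≤-refl
mddFrom-acc i acc (x ∷ xs) = ℤ.≤-trans (ℤ.i≤i⊔j acc _) (mddFrom-acc (suc i) _ xs)

mddFrom-≥ : ∀ i acc A y B → + y - + (i + length A) ℤ.+ 1ℤ ℤ.≤ mddFrom i acc (A ++ y ∷ B)
mddFrom-≥ i acc []      y B =
  subst (λ n → + y - + n ℤ.+ 1ℤ ℤ.≤ mddFrom i acc (y ∷ B)) (sym (+-identityʳ i))
    (ℤ.≤-trans (ℤ.i≤j⊔i acc _) (mddFrom-acc (suc i) _ B))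
mddFrom-≥ i acc (a ∷ A) y B =
  subst (λ n → + y - + n ℤ.+ 1ℤ ℤ.≤ mddFrom i acc (a ∷ A ++ y ∷ B)) (sym (+-suc i (length A)))
    (mddFrom-≥ (suc i) _ A y B)

mddFrom-attained : ∀ i acc xs → mddFrom i acc xs ≡ acc ⊎
  ∃ λ A → ∃ λ y → ∃ λ B → xs ≡ A ++ y ∷ B × mddFrom i acc xs ≡ + y - + (i + length A) ℤ.+ 1ℤ
mddFrom-attained i acc []       = inj₁ refl
mddFrom-attained i acc (x ∷ xs) with mddFrom-attained (suc i) (acc ℤ.⊔ (+ x - + i ℤ.+ 1ℤ)) xs
... | inj₂ (A , y , B , refl , m≡) =
  inj₂ (x ∷ A , y , B , refl , trans m≡ (cong (λ n → + y - + n ℤ.+ 1ℤ) (sym (+-suc i (length A)))))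
... | inj₁ m≡ with ℤ.⊔-sel acc (+ x - + i ℤ.+ 1ℤ)
...   | inj₁ ⊔≡acc = inj₁ (trans m≡ ⊔≡acc)
...   | inj₂ ⊔≡x   =
  inj₂ ([] , x , xs , refl , trans m≡ (trans ⊔≡x (cong (λ n → + x - + n ℤ.+ 1ℤ) (sym (+-identityʳ i)))))

shift-suc : ∀ (p q : ℤ) → p - (1ℤ ℤ.+ q) ℤ.+ 1ℤ ≡ p - q
shift-suc = ℤ-Ring.solve-∀

mdd-≥ : ∀ {x xs} A {y B} → x ∷ xs ≡ A ++ y ∷ B → + y - + length A ℤ.≤ mdd (x ∷ xs)
mdd-≥ {x} {xs} [] refl = subst (ℤ._≤ mdd (x ∷ xs)) (sym (ℤ.+-identityʳ (+ x))) (mddFrom-acc 2 (+ x) xs)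
mdd-≥ {x} (_ ∷ A) {y} {B} refl =
  subst (ℤ._≤ mdd (x ∷ A ++ y ∷ B)) (shift-suc (+ y) (+ suc (length A))) (mddFrom-≥ 2 (+ x) A y B)

mdd-attained : ∀ x xs →
  ∃ λ A → ∃ λ y → ∃ λ B → x ∷ xs ≡ A ++ y ∷ B × mdd (x ∷ xs) ≡ + y - + length A
mdd-attained x xs with mddFrom-attained 2 (+ x) xs
... | inj₁ m≡ = [] , x , xs , refl , trans m≡ (sym (ℤ.+-identityʳ (+ x)))
... | inj₂ (A , y , B , refl , m≡) = _ ∷ A , y , B , refl , trans m≡ (shift-suc (+ y) (+ suc (length A)))

excess : Seq → ℤ
excess σ = + length σ - + dist σ

-≤- : ∀ {a b c d} → a + d ≤ c + b → + a - + b ℤ.≤ + c - + d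
-≤- {a} {b} {c} {d} a+d≤c+b =
  ℤ.i-j≤0⇒i≤j (subst (ℤ._≤ 0ℤ) (sym (rearrange (+ a) (+ b) (+ c) (+ d))) (ℤ.i≤j⇒i-j≤0 (ℤ.+≤+ a+d≤c+b)))
  where
    rearrange : ∀ a b c d → (a - b) - (c - d) ≡ (a ℤ.+ d) - (c ℤ.+ b)
    rearrange = ℤ-Ring.solve-∀

excess+shift : ∀ ρ y a → excess ρ ℤ.+ (+ y - + a) ≡ + (length ρ + y) - + (dist ρ + a)
excess+shift ρ y a = rearrange (+ length ρ) (+ dist ρ) (+ y) (+ a)
  where
    rearrange : ∀ k e y a → (k - e) ℤ.+ (y - a) ≡ (k ℤ.+ y) - (e ℤ.+ a)
    rearrange = ℤ-Ring.solve-∀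

excess+shift-≤ : ∀ ρ y a σ → length ρ + y + dist σ ≤ length σ + (dist ρ + a) →
                 excess ρ ℤ.+ (+ y - + a) ℤ.≤ excess σ
excess+shift-≤ ρ y a σ le =
  subst (ℤ._≤ excess σ) (sym (excess+shift ρ y a)) (-≤- {length ρ + y} {dist ρ + a} {length σ} {dist σ} le)

≤-excess+shift : ∀ ρ y a σ → length σ + (dist ρ + a) ≤ length ρ + y + dist σ →
                 excess σ ℤ.≤ excess ρ ℤ.+ (+ y - + a)
≤-excess+shift ρ y a σ le =
  subst (excess σ ℤ.≤_) (sym (excess+shift ρ y a)) (-≤- {length σ} {dist σ} {length ρ + y} {dist ρ + a} le)

-- The two bounds

-- In an inversion sequence A ++ w ∷ B, the distinct values above |A| all occur in B.
dist-tail-bound : ∀ A w B {τB} → BoundedFrom 1 (A ++ w ∷ B) → τB ⊆ B →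
  dist (A ++ w ∷ B) + length τB ≤ length (A ++ w ∷ B) + distAbove w τB
dist-tail-bound A w B {τB} inv τB⊆B = begin
  dist σ + length τB                           ≤⟨ +-monoˡ-≤ _ (dist-≤ q σ) ⟩
  distAbove q σ + suc q + length τB            ≤⟨ +-monoˡ-≤ _ (+-monoˡ-≤ _ above-q) ⟩
  distAbove q B + suc q + length τB            ≡⟨ rearrange (distAbove q B) (suc q) (length τB) ⟩
  suc q + (length τB + distAbove q B)          ≤⟨ +-monoʳ-≤ (suc q) (countDistinct-⊆ (q <?_) τB⊆B) ⟩
  suc q + (length B + distAbove q τB)          ≤⟨ +-monoʳ-≤ (suc q) (+-monoʳ-≤ (length B) above-w) ⟩
  suc q + (length B + distAbove w τB)          ≡⟨ cong suc (+-assoc q (length B) _) ⟨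
  suc (q + length B) + distAbove w τB          ≡⟨ cong (λ n → n + distAbove w τB) length-σ ⟨
  length σ + distAbove w τB                    ∎
  where
    open ≤-Reasoning
    σ = A ++ w ∷ B
    q = length A
    length-σ : length σ ≡ suc (q + length B)
    length-σ = trans (length-++ A) (+-suc q (length B))
    w≤q : w ≤ q
    w≤q = s≤s⁻¹ (proj₁ (boundedFrom-++⁻ʳ A inv))
    A-below : All (λ v → ¬ q < v) A
    A-below = All.map (λ v<1+q → ≤⇒≯ (s≤s⁻¹ v<1+q)) (boundedFrom-All A (boundedFrom-++⁻ˡ A inv))
    above-q : distAbove q σ ≤ distAbove q B
    above-q = begin
      distAbove q (A ++ w ∷ B)               ≤⟨ countDistinct-++ (q <?_) A (w ∷ B) ⟩
      distAbove q A + distAbove q (w ∷ B)    ≡⟨ cong₂ _+_ (countDistinct-none (q <?_) A-below)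
                                                            (countDistinct-∷-reject (q <?_) B (≤⇒≯ w≤q)) ⟩
      distAbove q B                          ∎
    above-w : distAbove q τB ≤ distAbove w τB
    above-w = countDistinct-mono (q <?_) (w <?_) (≤-<-trans w≤q) τB
    rearrange : ∀ x s b → x + s + b ≡ s + (b + x)
    rearrange = ℕ-Ring.solve-∀

dist-tight-bound : ∀ A t B {τA} → BoundedFrom 1 A → DownClosed (A ++ t ∷ B) → t ≡ length A → τA ⊆ A →
  distAbove t (τA ++ t ∷ B) + suc t ≤ dist (A ++ t ∷ B)
dist-tight-bound A t B {τA} A-bounded closed refl τA⊆A = begin
  distAbove t (τA ++ t ∷ B) + suc t          ≤⟨ +-monoˡ-≤ (suc t) (countDistinct-++ (t <?_) τA (t ∷ B)) ⟩
  distAbove t τA + distAbove t (t ∷ B) + suc t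
                                             ≡⟨ cong (λ n → n + distAbove t (t ∷ B) + suc t) τA-below ⟩
  distAbove t (t ∷ B) + suc t                ≤⟨ +-monoˡ-≤ (suc t) (countDistinct-++ʳ (t <?_) A (t ∷ B)) ⟩
  distAbove t (A ++ t ∷ B) + suc t           ≡⟨ dist-≡ (closed (∈-++⁺ʳ A (here refl))) ⟨
  dist (A ++ t ∷ B)                          ∎
  where
    open ≤-Reasoning
    τA-below : distAbove t τA ≡ 0
    τA-below = countDistinct-none (t <?_)
      (All.map (λ v<1+t → ≤⇒≯ (s≤s⁻¹ v<1+t)) (All-resp-⊆ τA⊆A (boundedFrom-All A A-bounded)))

dist-proj₂ : ∀ {ps w y} → IsMatching ps → DownClosed (map proj₂ ps) → (w , y) ∈ ps →
  dist (map proj₂ ps) ≡ distAbove w (map proj₁ ps) + suc y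
dist-proj₂ {ps} {w} {y} matching closed wy∈ = begin
  dist (map proj₂ ps)                    ≡⟨ dist-≡ (closed (∈-map⁺ proj₂ wy∈)) ⟩
  distAbove y (map proj₂ ps) + suc y     ≡⟨ cong (λ n → n + suc y) above-y ⟨
  distAbove w (map proj₁ ps) + suc y     ∎
  where
    open ≡-Reasoning
    above-y = countDistinct-transfer (w <?_) (y <?_) matching (λ ab∈ → proj₁ (matching wy∈ ab∈))

excess-lower-bound-ℕ : ∀ {σ ps ρA y ρB} → BoundedFrom 1 σ → IsMatching ps → map proj₁ ps ⊆ σ →
  DownClosed (map proj₂ ps) → map proj₂ ps ≡ ρA ++ y ∷ ρB →
  length (map proj₂ ps) + y + dist σ ≤ length σ + (dist (map proj₂ ps) + length ρA)
excess-lower-bound-ℕ {σ} {ps} {ρA} {y} {ρB} inv matching τ⊆σ closed ρ≡ with map-split proj₂ ps ρA y ρB ρ≡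
... | psA , (w , _) , psB , refl , refl , refl , refl
  with ⊆-locate (map proj₁ psA) w (map proj₁ psB) (subst (_⊆ σ) (map-++ proj₁ psA _) τ⊆σ)
... | A , B , refl , _ , τB⊆B = begin
  length (map proj₂ ps) + y + dist σ             ≡⟨ cong (λ n → n + y + dist σ) length-ρ ⟩
  length ρA + suc (length τB) + y + dist σ       ≡⟨ rearrange (length ρA) (length τB) y (dist σ) ⟩
  (dist σ + length τB) + (suc y + length ρA)     ≤⟨ +-monoˡ-≤ _ (dist-tail-bound A w B inv τB⊆B) ⟩
  (length σ + distAbove w τB) + (suc y + length ρA)
                                                 ≤⟨ +-monoˡ-≤ _ (+-monoʳ-≤ (length σ) τB-above) ⟩
  (length σ + G) + (suc y + length ρA)           ≡⟨ rearrange′ (length σ) G y (length ρA) ⟩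
  length σ + ((G + suc y) + length ρA)           ≡⟨ cong (λ n → length σ + (n + length ρA)) dist-ρ ⟨
  length σ + (dist (map proj₂ ps) + length ρA)   ∎
  where
    open ≤-Reasoning
    τA = map proj₁ psA
    τB = map proj₁ psB
    G = distAbove w (map proj₁ ps)
    dist-ρ = dist-proj₂ matching closed (∈-++⁺ʳ psA (here refl))
    length-ρ : length (map proj₂ ps) ≡ length ρA + suc (length τB)
    length-ρ = begin-equality
      length (map proj₂ ps)                      ≡⟨ cong length (map-++ proj₂ psA _) ⟩
      length (ρA ++ y ∷ map proj₂ psB)           ≡⟨ length-++ ρA ⟩
      length ρA + suc (length (map proj₂ psB))   ≡⟨ cong (λ n → length ρA + suc n)
                                                      (trans (length-map proj₂ psB) (sym (length-map proj₁ psB))) ⟩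
      length ρA + suc (length τB)                ∎
    τB-above : distAbove w τB ≤ G
    τB-above = begin
      distAbove w τB                 ≤⟨ countDistinct-∷ (w <?_) w τB ⟩
      distAbove w (w ∷ τB)           ≤⟨ countDistinct-++ʳ (w <?_) τA (w ∷ τB) ⟩
      distAbove w (τA ++ w ∷ τB)     ≡⟨ cong (distAbove w) (map-++ proj₁ psA _) ⟨
      G                              ∎
    rearrange : ∀ a b y d → a + suc b + y + d ≡ (d + b) + (suc y + a)
    rearrange = ℕ-Ring.solve-∀
    rearrange′ : ∀ s g y a → (s + g) + (suc y + a) ≡ s + ((g + suc y) + a)
    rearrange′ = ℕ-Ring.solve-∀

excess-upper-bound-ℕ : ∀ {A t B ps τA} → BoundedFrom 1 A → DownClosed (A ++ t ∷ B) → t ≡ length A →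
  IsMatching ps → DownClosed (map proj₂ ps) → map proj₁ ps ≡ τA ++ t ∷ B → τA ⊆ A →
  ∃ λ ρA → ∃ λ y → ∃ λ ρB → map proj₂ ps ≡ ρA ++ y ∷ ρB ×
    length (A ++ t ∷ B) + (dist (map proj₂ ps) + length ρA) ≤ length (map proj₂ ps) + y + dist (A ++ t ∷ B)
excess-upper-bound-ℕ {A} {t} {B} {ps} {τA} A-bounded closed t≡ matching ρ-closed τ≡ τA⊆A
  with map-split proj₁ ps τA t B τ≡
... | psA , (_ , y) , psB , refl , refl , refl , refl =
  ρA , y , map proj₂ psB , map-++ proj₂ psA _ , (begin
  length σ + (dist (map proj₂ ps) + length ρA)   ≡⟨ cong₂ (λ m n → m + (n + length ρA)) length-σ dist-ρ ⟩
  (t + suc b) + ((G + suc y) + length ρA)        ≡⟨ rearrange t b G y (length ρA) ⟩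
  (G + suc t) + (length ρA + suc b + y)          ≤⟨ +-monoˡ-≤ _ (dist-tight-bound A t B A-bounded closed t≡ τA⊆A) ⟩
  dist σ + (length ρA + suc b + y)               ≡⟨ +-comm (dist σ) _ ⟩
  length ρA + suc b + y + dist σ                 ≡⟨ cong (λ n → n + y + dist σ) length-ρ ⟨
  length (map proj₂ ps) + y + dist σ             ∎)
  where
    open ≤-Reasoning
    σ = A ++ t ∷ B
    ρA = map proj₂ psA
    b = length psB
    G = distAbove t (map proj₁ psA ++ t ∷ B)
    dist-ρ : dist (map proj₂ ps) ≡ G + suc y
    dist-ρ = trans (dist-proj₂ matching ρ-closed (∈-++⁺ʳ psA (here refl)))
                   (cong (λ τ → distAbove t τ + suc y) (map-++ proj₁ psA _))
    length-σ : length σ ≡ t + suc b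
    length-σ = trans (length-++ A) (cong₂ (λ m n → m + suc n) (sym t≡) (length-map proj₁ psB))
    length-ρ : length (map proj₂ ps) ≡ length ρA + suc b
    length-ρ = trans (cong length (map-++ proj₂ psA _))
                     (trans (length-++ ρA) (cong (λ n → length ρA + suc n) (length-map proj₂ psB)))
    rearrange : ∀ t b g y a → (t + suc b) + ((g + suc y) + a) ≡ (g + suc t) + (a + suc b + y)
    rearrange = ℕ-Ring.solve-∀

excess-lower-bound : ∀ {ρ σ ρA y ρB} → IsCayley ρ → InIP ρ σ → ρ ≡ ρA ++ y ∷ ρB →
  excess ρ ℤ.+ (+ y - + length ρA) ℤ.≤ excess σ
excess-lower-bound {ρ} {σ} {ρA} {y} cayley (inv , _ , τ , τ⊆σ , τ≅ρ) ρ≡ with orderIso⇒matching {τ} {ρ} τ≅ρ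
... | ps , matching , refl , refl = excess+shift-≤ ρ y (length ρA) σ
  (excess-lower-bound-ℕ (boundedFrom-lookup 1 σ inv) matching τ⊆σ (isCayley⇒downClosed ρ cayley) ρ≡)

excess-upper-bound : ∀ {ρ σ} → IsCayley ρ → IsMinimal ρ σ → ρ ≢ [] →
  ∃ λ ρA → ∃ λ y → ∃ λ ρB → ρ ≡ ρA ++ y ∷ ρB × excess σ ℤ.≤ excess ρ ℤ.+ (+ y - + length ρA)
excess-upper-bound {ρ} {σ} cayley minimal@((inv , σ-cayley , τ , τ⊆σ , τ≅ρ) , _) ρ≢[]
  with boundedFrom-lastTight 0 σ (boundedFrom-lookup 1 σ inv)
... | inj₁ σ-bounded₀ =
  ⊥-elim (ρ≢[] (occurrence-in-[] (subst (τ ⊆_) (boundedFrom-zero σ-bounded₀) τ⊆σ) τ≅ρ))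
... | inj₂ (A , t , B , refl , t≡ , B-bounded) with minimal-covers-suffix {ρ} minimal B-bounded τ⊆σ τ≅ρ
... | τA , τA⊆A , refl with orderIso⇒matching {τA ++ t ∷ B} {ρ} τ≅ρ
... | ps , matching , τ≡ , refl
  with excess-upper-bound-ℕ (boundedFrom-++⁻ˡ A (boundedFrom-lookup 1 _ inv)) (isCayley⇒downClosed _ σ-cayley)
         t≡ matching (isCayley⇒downClosed ρ cayley) τ≡ τA⊆A
... | ρA , y , ρB , ρ≡ , bound = ρA , y , ρB , ρ≡ , ≤-excess+shift ρ y (length ρA) (A ++ t ∷ B) bound

lemma3p3 : (x : ℕ) (xs : List ℕ) (σ : List ℕ) →
    IsCayley (x ∷ xs) → IsMinimal (x ∷ xs) σ →
    (+ length σ) - (+ dist σ)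
      ≡ ((+ length (x ∷ xs)) - (+ dist (x ∷ xs))) ℤ.+ mdd (x ∷ xs)
lemma3p3 x xs σ cayley minimal
  with mdd-attained x xs | excess-upper-bound {x ∷ xs} cayley minimal (λ ())
... | A , y , B , ρ≡ , mdd≡ | A′ , y′ , B′ , ρ≡′ , upper = ℤ.≤-antisym
  (ℤ.≤-trans upper (ℤ.+-monoʳ-≤ (excess (x ∷ xs)) (mdd-≥ A′ ρ≡′)))
  (subst (λ m → excess (x ∷ xs) ℤ.+ m ℤ.≤ excess σ) (sym mdd≡) (excess-lower-bound cayley (proj₁ minimal) ρ≡))
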